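{- Let $\vec{G}$ be an oriented graph that admits a degree-preserving out-neighbourhood bijective homomorphism $\psi$ to a strongly connected oriented graph $\vec{H}$. Then $|\psi^{ -1}(u)|=|\psi^{ -1}(v)|$ for all $u,v\in V(\vec{H})$.
   Context: Oriented graphs are finite orientations of simple graphs. An out-neighbourhood bijective homomorphism from $\vec{G}$ to $\vec{H}$ is a map $\psi\colon V(\vec{G})\to V(\vec{H})$ such that for every vertex $v$ the restriction of $\psi$ to $N^+_{\vec{G}}(v)$ is a bijection onto $N^+_{\vec{H}}(\psi(v))$. It is degree-preserving if the (total, underlying undirected) degree of $v$ in $\vec{G}$ equals that of $\psi(v)$ in $\vec{H}$ for every $v$. $\vec{H}$ is strongly connected if there is a directed path between any ordered pair of vertices. -}

module Defs where

open import Data.Nat using (ℕ; zero; suc; _+_)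
open import Data.Fin using (Fin; zero; suc; _≟_)
open import Data.Bool using (Bool; true; false; _∨_; if_then_else_; T)
open import Data.Product using (Σ; _×_; _,_)
open import Relation.Binary.PropositionalEquality using (_≡_)
open import Relation.Nullary.Decidable using (⌊_⌋)
open import Relation.Binary.Construct.Closure.ReflexiveTransitive using (Star)

record OrientedGraph : Set where
  field
    size    : ℕ
    arc     : Fin size → Fin size → Bool
    irrefl  : ∀ v → arc v v ≡ false
    oriented : ∀ u v → arc u v ≡ true → arc v u ≡ false

open OrientedGraph public

countFin : ∀ {n} → (Fin n → Bool) → ℕ
countFin {zero}  p = 0
countFin {suc n} p = (if p zero then 1 else 0) + countFin (λ i → p (suc i))

degree : (G : OrientedGraph) → Fin (size G) → ℕ
degree G v = countFin (λ w → arc G v w ∨ arc G w v)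

IsOutNbhdBijective : (G H : OrientedGraph) → (Fin (size G) → Fin (size H)) → Set
IsOutNbhdBijective G H ψ =
  (∀ v w → T (arc G v w) → T (arc H (ψ v) (ψ w)))
  × (∀ v w w′ → T (arc G v w) → T (arc G v w′) → ψ w ≡ ψ w′ → w ≡ w′)
  × (∀ v x → T (arc H (ψ v) x) → Σ (Fin (size G)) λ w → T (arc G v w) × ψ w ≡ x)

IsDegreePreserving : (G H : OrientedGraph) → (Fin (size G) → Fin (size H)) → Set
IsDegreePreserving G H ψ = ∀ v → degree G v ≡ degree H (ψ v)

Reachable : (H : OrientedGraph) → Fin (size H) → Fin (size H) → Set
Reachable H = Star (λ a b → T (arc H a b))

StronglyConnected : OrientedGraph → Set
StronglyConnected H = ∀ u v → Reachable H u v

fibreSize : ∀ {m n} → (Fin m → Fin n) → Fin n → ℕ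
fibreSize ψ u = countFin (λ v → ⌊ ψ v ≟ u ⌋)

{-# OPTIONS --safe #-}
-- Counting, for each out-neighbour y of ψ v, its unique preimage among the
-- out-neighbours of v shows that ψ preserves out-degrees, hence (being
-- degree-preserving) in-degrees too. Double counting the arcs of G that end
-- in ψ⁻¹(y), by heads and by tails, gives
--   |ψ⁻¹(y)| · d⁻(y) = Σ_{x→y} |ψ⁻¹(x)|,
-- i.e. the fibre size at y is the mean of its values at the in-neighbours of y.
-- A maximum of such a function spreads backwards along arcs, so on a strongly
-- connected graph the function is constant.

module Submission where

open import Defs
open import Data.Bool using (Bool; true; false; _∨_; if_then_else_; T)
open import Data.Bool.Properties using (T-≡)
open import Data.Empty using (⊥-elim)
open import Data.Fin using (Fin; zero; suc; _≟_; punchIn)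
open import Data.Fin.Properties using (punchInᵢ≢i)
open import Data.List using (allFin)
open import Data.List.Extrema.Nat using (argmax; f[xs]≤f[argmax])
open import Data.List.Membership.Propositional.Properties using (∈-allFin)
import Data.List.Relation.Unary.All as All
open import Data.Nat using (ℕ; zero; suc; _+_; _*_; _≤_; z≤n)
open import Data.Nat.Properties hiding (_≟_)
open import Data.Product using (Σ; _×_; _,_; proj₁; proj₂)
open import Data.Vec.Functional using (removeAt)
open import Function using (_∘_; Equivalence)
open import Relation.Binary.Construct.Closure.ReflexiveTransitive using (ε; _◅_)
open import Relation.Binary.PropositionalEquality
  using (_≡_; _≢_; refl; sym; trans; cong; subst; module ≡-Reasoning)
open import Relation.Nullary using (yes; no)
open import Relation.Nullary.Decidable using (⌊_⌋)

open import Algebra.Properties.Semiring.Sum +-*-semiring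
  using (sum; sum-syntax; sum-cong-≗; sum-remove; sum-replicate-zero;
         ∑-comm; ∑-distrib-+; *-distribˡ-sum; *-distribʳ-sum)

sum-zero : ∀ {n} {f : Fin n → ℕ} → (∀ i → f i ≡ 0) → sum f ≡ 0
sum-zero {n} f≗0 = trans (sum-cong-≗ f≗0) (sum-replicate-zero n)

sum-single : ∀ {n} (f : Fin n → ℕ) k → (∀ i → i ≢ k → f i ≡ 0) → sum f ≡ f k
sum-single {suc n} f k f≗0 = begin
  sum f                    ≡⟨ sum-remove f ⟩
  f k + sum (removeAt f k) ≡⟨ cong (f k +_) (sum-zero (λ i → f≗0 _ (punchInᵢ≢i k i))) ⟩
  f k + 0                  ≡⟨ +-identityʳ (f k) ⟩
  f k                      ∎
  where open ≡-Reasoning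

sum-mono-≤ : ∀ {n} {f g : Fin n → ℕ} → (∀ i → f i ≤ g i) → sum f ≤ sum g
sum-mono-≤ {zero}  f≤g = z≤n
sum-mono-≤ {suc n} f≤g = +-mono-≤ (f≤g zero) (sum-mono-≤ (f≤g ∘ suc))

sum-≡-pointwise-≤⇒≡ : ∀ {n} {f g : Fin n → ℕ} →
  (∀ i → f i ≤ g i) → sum f ≡ sum g → ∀ i → f i ≡ g i
sum-≡-pointwise-≤⇒≡ {suc n} {f} {g} f≤g Σf≡Σg i = ≤-antisym (f≤g i) gᵢ≤fᵢ
  where
  rest : (Fin (suc n) → ℕ) → ℕ
  rest h = sum (removeAt h i)
  gᵢ≤fᵢ : g i ≤ f i
  gᵢ≤fᵢ = +-cancelʳ-≤ (rest g) (g i) (f i) (begin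
    g i + rest g  ≡⟨ sym (sum-remove g) ⟩
    sum g         ≡⟨ sym Σf≡Σg ⟩
    sum f         ≡⟨ sum-remove f ⟩
    f i + rest f  ≤⟨ +-monoʳ-≤ (f i) (sum-mono-≤ (f≤g ∘ punchIn i)) ⟩
    f i + rest g  ∎)
    where open ≤-Reasoning

[_] : Bool → ℕ
[ b ] = if b then 1 else 0

[]-∨ : ∀ a b → (a ≡ true → b ≡ false) → [ a ∨ b ] ≡ [ a ] + [ b ]
[]-∨ true  true  a⇒¬b with a⇒¬b refl
... | ()
[]-∨ true  false _ = refl
[]-∨ false b     _ = refl

countFin≡sum : ∀ {n} (p : Fin n → Bool) → countFin p ≡ ∑[ i < n ] [ p i ]
countFin≡sum {zero}  p = refl
countFin≡sum {suc n} p = cong ([ p zero ] +_) (countFin≡sum (p ∘ suc))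

δ : ∀ {n} → Fin n → Fin n → ℕ
δ a b = [ ⌊ a ≟ b ⌋ ]

δ-refl : ∀ {n} (a : Fin n) → δ a a ≡ 1
δ-refl a with a ≟ a
... | yes _   = refl
... | no a≢a = ⊥-elim (a≢a refl)

δ-≢ : ∀ {n} {a b : Fin n} → a ≢ b → δ a b ≡ 0
δ-≢ {a = a} {b} a≢b with a ≟ b
... | yes a≡b = ⊥-elim (a≢b a≡b)
... | no _    = refl

δ-sift : ∀ {n} (a : Fin n) (h : Fin n → ℕ) → ∑[ x < n ] (δ a x * h x) ≡ h a
δ-sift a h = trans (sum-single _ a (λ x x≢a → cong (_* h x) (δ-≢ (x≢a ∘ sym))))
                   (trans (cong (_* h a) (δ-refl a)) (*-identityˡ (h a)))

∑δ≡1 : ∀ {n} (a : Fin n) → ∑[ x < n ] δ a x ≡ 1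
∑δ≡1 a = trans (sum-cong-≗ (λ x → sym (*-identityʳ (δ a x)))) (δ-sift a (λ _ → 1))

[]*δ≡0 : ∀ {b n} {a c : Fin n} → (T b → a ≢ c) → [ b ] * δ a c ≡ 0
[]*δ≡0 {false} _   = refl
[]*δ≡0 {true}  a≢c = trans (*-identityˡ _) (δ-≢ (a≢c _))

[]*δ≡1 : ∀ {b n} {a c : Fin n} → T b → a ≡ c → [ b ] * δ a c ≡ 1
[]*δ≡1 {true} {a = a} _ refl = trans (*-identityˡ _) (δ-refl a)

*δ-cong : ∀ {k l n} {a c : Fin n} → (a ≡ c → k ≡ l) → k * δ a c ≡ l * δ a c
*δ-cong {k} {l} {a = a} {c} k≡l with a ≟ c
... | yes a≡c = cong (_* 1) (k≡l a≡c)
... | no _    = trans (*-zeroʳ k) (sym (*-zeroʳ l))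

fibreSize≡∑δ : ∀ {m n} (ψ : Fin m → Fin n) u → fibreSize ψ u ≡ ∑[ v < m ] δ (ψ v) u
fibreSize≡∑δ ψ u = countFin≡sum (λ v → ⌊ ψ v ≟ u ⌋)

outdegree indegree : (K : OrientedGraph) → Fin (size K) → ℕ
outdegree K v = ∑[ w < size K ] [ arc K v w ]
indegree  K w = ∑[ v < size K ] [ arc K v w ]

degree≡outdegree+indegree : ∀ K v → degree K v ≡ outdegree K v + indegree K v
degree≡outdegree+indegree K v = begin
  degree K v                                           ≡⟨ countFin≡sum (λ w → arc K v w ∨ arc K w v) ⟩
  ∑[ w < size K ] [ arc K v w ∨ arc K w v ]             ≡⟨ sum-cong-≗ (λ w → []-∨ _ _ (oriented K v w)) ⟩
  ∑[ w < size K ] ([ arc K v w ] + [ arc K w v ])       ≡⟨ ∑-distrib-+ (λ w → [ arc K v w ]) (λ w → [ arc K w v ]) ⟩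
  outdegree K v + indegree K v                         ∎
  where open ≡-Reasoning

InMeanValue : (H : OrientedGraph) → (Fin (size H) → ℕ) → Set
InMeanValue H f = ∀ y → ∑[ x < size H ] (f x * [ arc H x y ]) ≡ f y * indegree H y

module MaximumPrinciple (H : OrientedGraph) (f : Fin (size H) → ℕ) (mean : InMeanValue H f) where

  max-pulls-back-along-arc : ∀ {M} → (∀ x → f x ≤ M) →
    ∀ {x y} → T (arc H x y) → f y ≡ M → f x ≡ M
  max-pulls-back-along-arc {M} f≤M {x} {y} x→y fy≡M =
    trans (sym (*-identityʳ (f x))) (trans fx*1≡M*1 (*-identityʳ M))
    where
    sums-agree : ∑[ x′ < size H ] (f x′ * [ arc H x′ y ]) ≡ ∑[ x′ < size H ] (M * [ arc H x′ y ])
    sums-agree = trans (mean y) (trans (cong (_* indegree H y) fy≡M)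
                                     (*-distribˡ-sum M (λ x′ → [ arc H x′ y ])))
    fx*a≡M*a : f x * [ arc H x y ] ≡ M * [ arc H x y ]
    fx*a≡M*a = sum-≡-pointwise-≤⇒≡ (λ x′ → *-monoˡ-≤ [ arc H x′ y ] (f≤M x′)) sums-agree x
    fx*1≡M*1 : f x * 1 ≡ M * 1
    fx*1≡M*1 = subst (λ b → f x * [ b ] ≡ M * [ b ]) (Equivalence.to T-≡ x→y) fx*a≡M*a

  max-pulls-back-along-walk : ∀ {M} → (∀ x → f x ≤ M) →
    ∀ {x y} → Reachable H x y → f y ≡ M → f x ≡ M
  max-pulls-back-along-walk f≤M ε            fy≡M = fy≡M
  max-pulls-back-along-walk f≤M (x→z ◅ z⇝y) fy≡M =
    max-pulls-back-along-arc f≤M x→z (max-pulls-back-along-walk f≤M z⇝y fy≡M)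

  constant-if-stronglyConnected : StronglyConnected H → ∀ u v → f u ≡ f v
  constant-if-stronglyConnected reach u v = trans (to-max u) (sym (to-max v))
    where
    m : Fin (size H)
    m = argmax f u (allFin (size H))
    f≤fm : ∀ x → f x ≤ f m
    f≤fm x = All.lookup (f[xs]≤f[argmax] {f = f} u (allFin (size H))) (∈-allFin x)
    to-max : ∀ x → f x ≡ f m
    to-max x = max-pulls-back-along-walk f≤fm (reach x m) refl

module OutNbhdBijective (G H : OrientedGraph) (ψ : Fin (size G) → Fin (size H))
                        (bij : IsOutNbhdBijective G H ψ) where

  private
    arc-preserving : ∀ v w → T (arc G v w) → T (arc H (ψ v) (ψ w))
    arc-preserving = proj₁ bij

    injective-on-out : ∀ v w w′ → T (arc G v w) → T (arc G v w′) → ψ w ≡ ψ w′ → w ≡ w′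
    injective-on-out = proj₁ (proj₂ bij)

    surjective-on-out : ∀ v x → T (arc H (ψ v) x) → Σ (Fin (size G)) λ w → T (arc G v w) × ψ w ≡ x
    surjective-on-out = proj₂ (proj₂ bij)

  out-arcs-over : ∀ v y → ∑[ w < size G ] ([ arc G v w ] * δ (ψ w) y) ≡ [ arc H (ψ v) y ]
  out-arcs-over v y with arc H (ψ v) y in ψv→y
  ... | false = sum-zero (λ w → []*δ≡0 λ v→w ψw≡y →
          subst T ψv→y (subst (T ∘ arc H (ψ v)) ψw≡y (arc-preserving v w v→w)))
  ... | true with surjective-on-out v y (Equivalence.from T-≡ ψv→y)
  ...   | w₀ , v→w₀ , ψw₀≡y = trans (sum-single _ w₀ others) ([]*δ≡1 v→w₀ ψw₀≡y)
    where
    others : ∀ w → w ≢ w₀ → [ arc G v w ] * δ (ψ w) y ≡ 0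
    others w w≢w₀ = []*δ≡0 λ v→w ψw≡y →
      w≢w₀ (injective-on-out v w w₀ v→w v→w₀ (trans ψw≡y (sym ψw₀≡y)))

  outdegree-preserved : ∀ v → outdegree G v ≡ outdegree H (ψ v)
  outdegree-preserved v = begin
    ∑[ w < size G ] [ arc G v w ]
      ≡⟨ sum-cong-≗ (λ w → sym (*-identityʳ [ arc G v w ])) ⟩
    ∑[ w < size G ] ([ arc G v w ] * 1)
      ≡⟨ sum-cong-≗ (λ w → cong ([ arc G v w ] *_) (sym (∑δ≡1 (ψ w)))) ⟩
    ∑[ w < size G ] ([ arc G v w ] * ∑[ y < size H ] δ (ψ w) y)
      ≡⟨ sum-cong-≗ (λ w → *-distribˡ-sum [ arc G v w ] (δ (ψ w))) ⟩
    ∑[ w < size G ] ∑[ y < size H ] ([ arc G v w ] * δ (ψ w) y)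
      ≡⟨ ∑-comm (λ w y → [ arc G v w ] * δ (ψ w) y) ⟩
    ∑[ y < size H ] ∑[ w < size G ] ([ arc G v w ] * δ (ψ w) y)
      ≡⟨ sum-cong-≗ (out-arcs-over v) ⟩
    ∑[ y < size H ] [ arc H (ψ v) y ]
      ∎
    where open ≡-Reasoning

  module _ (degree-preserving : IsDegreePreserving G H ψ) where

    indegree-preserved : ∀ w → indegree G w ≡ indegree H (ψ w)
    indegree-preserved w = +-cancelˡ-≡ (outdegree G w) _ _ (begin
      outdegree G w + indegree G w          ≡⟨ sym (degree≡outdegree+indegree G w) ⟩
      degree G w                            ≡⟨ degree-preserving w ⟩
      degree H (ψ w)                        ≡⟨ degree≡outdegree+indegree H (ψ w) ⟩
      outdegree H (ψ w) + indegree H (ψ w)  ≡⟨ cong (_+ indegree H (ψ w)) (sym (outdegree-preserved w)) ⟩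
      outdegree G w + indegree H (ψ w)      ∎)
      where open ≡-Reasoning

    fibreSize-inMeanValue : InMeanValue H (fibreSize ψ)
    fibreSize-inMeanValue y = begin
      ∑[ x < size H ] (fibreSize ψ x * [ arc H x y ])
        ≡⟨ sum-cong-≗ (λ x → cong (_* [ arc H x y ]) (fibreSize≡∑δ ψ x)) ⟩
      ∑[ x < size H ] (∑[ v < size G ] δ (ψ v) x * [ arc H x y ])
        ≡⟨ sum-cong-≗ (λ x → *-distribʳ-sum [ arc H x y ] (λ v → δ (ψ v) x)) ⟩
      ∑[ x < size H ] ∑[ v < size G ] (δ (ψ v) x * [ arc H x y ])
        ≡⟨ ∑-comm (λ x v → δ (ψ v) x * [ arc H x y ]) ⟩
      ∑[ v < size G ] ∑[ x < size H ] (δ (ψ v) x * [ arc H x y ])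
        ≡⟨ sum-cong-≗ (λ v → δ-sift (ψ v) (λ x → [ arc H x y ])) ⟩
      ∑[ v < size G ] [ arc H (ψ v) y ]
        ≡⟨ sum-cong-≗ (λ v → sym (out-arcs-over v y)) ⟩
      ∑[ v < size G ] ∑[ w < size G ] ([ arc G v w ] * δ (ψ w) y)
        ≡⟨ ∑-comm (λ v w → [ arc G v w ] * δ (ψ w) y) ⟩
      ∑[ w < size G ] ∑[ v < size G ] ([ arc G v w ] * δ (ψ w) y)
        ≡⟨ sum-cong-≗ (λ w → sym (*-distribʳ-sum (δ (ψ w) y) (λ v → [ arc G v w ]))) ⟩
      ∑[ w < size G ] (indegree G w * δ (ψ w) y)
        ≡⟨ sum-cong-≗ (λ w → *δ-cong (λ ψw≡y → trans (indegree-preserved w) (cong (indegree H) ψw≡y))) ⟩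
      ∑[ w < size G ] (indegree H y * δ (ψ w) y)
        ≡⟨ sym (*-distribˡ-sum (indegree H y) (λ w → δ (ψ w) y)) ⟩
      indegree H y * ∑[ w < size G ] δ (ψ w) y
        ≡⟨ cong (indegree H y *_) (sym (fibreSize≡∑δ ψ y)) ⟩
      indegree H y * fibreSize ψ y
        ≡⟨ *-comm (indegree H y) (fibreSize ψ y) ⟩
      fibreSize ψ y * indegree H y
        ∎
      where open ≡-Reasoning

theorem6 : (G H : OrientedGraph) (ψ : Fin (size G) → Fin (size H))
    → IsOutNbhdBijective G H ψ → IsDegreePreserving G H ψ → StronglyConnected H
    → ∀ u v → fibreSize ψ u ≡ fibreSize ψ v
theorem6 G H ψ bij degree-preserving =
  MaximumPrinciple.constant-if-stronglyConnected H (fibreSize ψ)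
    (OutNbhdBijective.fibreSize-inMeanValue G H ψ bij degree-preserving)
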